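{- Let \((X,\sqsubseteq)\) be a locally small \(\delta_{\mathcal V}\)-complete poset and \(x,y:X\) with \(x\sqsubseteq y\). Then \(x\neq y\) (so that \((X,\sqsubseteq,x,y)\) is nontrivial) if and only if the composite \(\Omega^{\lnot\lnot}_{\mathcal V}\hookrightarrow\Omega_{\mathcal V}\xrightarrow{\Delta_{x,y}}X\) is a section, i.e. has a left inverse \(r:X\to\Omega^{\lnot\lnot}_{\mathcal V}\).
   Context: Work in univalent foundations (intensional Martin-Löf type theory with universes, function and propositional extensionality, propositional truncations). \(\Omega_{\mathcal V}\) is the type of propositions in \(\mathcal V\), \(\Omega^{\lnot\lnot}_{\mathcal V}\) the type of propositions \(P:\mathcal V\) with \(\lnot\lnot P\to P\), and \(\Omega^{\lnot\lnot}_{\mathcal V}\hookrightarrow\Omega_{\mathcal V}\) the inclusion. A poset is a type with a proposition-valued reflexive, transitive, antisymmetric relation \(\sqsubseteq\). It is \(\delta_{\mathcal V}\)-complete if for all \(a\sqsubseteq b\) and propositions \(P:\mathcal V\) the family \(\delta_{a,b,P}:\mathbf 1+P\to X\), \(\mathrm{inl}(\star)\mapsto a\), \(\mathrm{inr}(p)\mapsto b\), has a supremum \(\bigvee\delta_{a,b,P}\). It is locally small if there is \(\sqsubseteq_{\mathcal V}:X\to X\to\mathcal V\) with \((a\sqsubseteq b)\simeq(a\sqsubseteq_{\mathcal V}b)\). \(\Delta_{x,y}:\Omega_{\mathcal V}\to X\) is \(P\mapsto\bigvee\delta_{x,y,P}\). A map \(s\) is a section if there is \(r\) with \(r\circ s\sim\mathrm{id}\).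 -}

module Defs where

open import Level using (Level; _⊔_) renaming (suc to lsuc)
open import Data.Product using (Σ; _×_; _,_; proj₁; proj₂)
open import Data.Sum using (_⊎_; inj₁; inj₂)
open import Data.Unit.Polymorphic using (⊤)
open import Relation.Nullary using (¬_)
open import Relation.Binary.PropositionalEquality using (_≡_)
open import Function.Bundles using (_↔_)
open import Axiom.Extensionality.Propositional using (Extensionality)

isProp : ∀ {a} → Set a → Set a
isProp A = (x y : A) → x ≡ y

PropExt : (v : Level) → Set (lsuc v)
PropExt v = {P Q : Set v} → isProp P → isProp Q → (P → Q) → (Q → P) → P ≡ Q

Ω : (v : Level) → Set (lsuc v)
Ω v = Σ (Set v) isProp

Ω¬¬ : (v : Level) → Set (lsuc v)
Ω¬¬ v = Σ (Set v) (λ P → isProp P × (¬ ¬ P → P))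

ι : ∀ {v} → Ω¬¬ v → Ω v
ι (P , i , _) = P , i

record Poset (u w : Level) : Set (lsuc (u ⊔ w)) where
  field
    Carrier      : Set u
    _⊑_          : Carrier → Carrier → Set w
    ⊑-prop       : (a b : Carrier) → isProp (a ⊑ b)
    ⊑-refl       : (a : Carrier) → a ⊑ a
    ⊑-trans      : (a b c : Carrier) → a ⊑ b → b ⊑ c → a ⊑ c
    ⊑-antisym    : (a b : Carrier) → a ⊑ b → b ⊑ a → a ≡ b

module _ {u w : Level} (𝓧 : Poset u w) where
  open Poset 𝓧

  isSup : ∀ {i} {I : Set i} → (I → Carrier) → Carrier → Set (u ⊔ w ⊔ i)
  isSup {I = I} α s = ((k : I) → α k ⊑ s)
                    × ((t : Carrier) → ((k : I) → α k ⊑ t) → s ⊑ t)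

  δ : ∀ {v} (a b : Carrier) (P : Set v) → ⊤ {v} ⊎ P → Carrier
  δ a b P (inj₁ _) = a
  δ a b P (inj₂ _) = b

  δ-complete : (v : Level) → Set (u ⊔ w ⊔ lsuc v)
  δ-complete v = (a b : Carrier) → a ⊑ b → (P : Set v) → isProp P
               → Σ Carrier (isSup (δ a b P))

  LocallySmall : (v : Level) → Set (u ⊔ w ⊔ lsuc v)
  LocallySmall v = Σ (Carrier → Carrier → Set v) (λ _⊑V_ → (a b : Carrier) → (a ⊑ b) ↔ (a ⊑V b))

  Δ : ∀ {v} → δ-complete v → (x y : Carrier) → x ⊑ y → Ω v → Carrier
  Δ c x y x⊑y (P , i) = proj₁ (c x y x⊑y P i)

{-# OPTIONS --safe #-}
-- If x ≠ y, the retraction sends z to ¬ (z ⊑ x): the supremum of δ_{x,y,P} lies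
-- below x exactly when ¬ P, so it recovers ¬ ¬ P, which is P for a ¬¬-stable P.
-- If x = y, every δ_{x,x,P} has supremum x, so Δ_{x,y} ∘ ι is constant and
-- cannot have a left inverse, since Ω¬¬ contains the distinct ⊥ and ⊤.
module Submission where

open import Defs
open import Level using (Level; 0ℓ; lower)
open import Data.Product using (Σ; _,_; proj₁; proj₂)
open import Data.Sum using (inj₁; inj₂)
open import Data.Empty using (⊥-elim)
open import Data.Empty.Polymorphic using (⊥)
open import Data.Unit.Polymorphic using (⊤)
open import Relation.Nullary using (¬_)
open import Relation.Binary.PropositionalEquality
  using (_≡_; _≢_; refl; sym; trans; cong; subst; module ≡-Reasoning)
open import Data.Product.Properties using (×-≡,≡→≡)
open import Function.Base using (_∘_)
open import Function.Bundles using (_⇔_; mk⇔; Inverse)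
open import Axiom.Extensionality.Propositional
  using (Extensionality; lower-extensionality)
open import Axiom.UniquenessOfIdentityProofs using (module Constant⇒UIP)

private
  variable
    a b u w v : Level

isProp-≡ : {A : Set a} → isProp A → {x y : A} → isProp (x ≡ y)
isProp-≡ A-prop = Constant⇒UIP.≡-irrelevant
  (λ {x} {y} _ → A-prop x y) (λ _ _ → refl)

isProp-Π : Extensionality a b → {A : Set a} {B : A → Set b}
         → ((x : A) → isProp (B x)) → isProp ((x : A) → B x)
isProp-Π ext B-prop f g = ext λ x → B-prop x (f x) (g x)

isProp-isProp : Extensionality a a → {A : Set a} → isProp (isProp A)
isProp-isProp ext p q =
  isProp-Π ext (λ _ → isProp-Π ext λ _ → isProp-≡ p) p q

isProp-¬ : Extensionality a 0ℓ → {A : Set a} → isProp (¬ A)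
isProp-¬ ext = isProp-Π ext λ _ ()

Ω¬¬-≡ : Extensionality v v → (P Q : Ω¬¬ v) → proj₁ P ≡ proj₁ Q → P ≡ Q
Ω¬¬-≡ {v} ext (P , i , s) (.P , i′ , s′) refl = cong (P ,_)
  (×-≡,≡→≡ (isProp-isProp ext i i′ , isProp-Π (lower-extensionality 0ℓ v ext) (λ _ → i) s s′))

¬-Ω¬¬ : Extensionality v 0ℓ → Set v → Ω¬¬ v
¬-Ω¬¬ ext A = (¬ A) , isProp-¬ ext , λ ¬¬¬A x → ¬¬¬A λ ¬A → ¬A x

⊥Ω¬¬ : Ω¬¬ v
⊥Ω¬¬ = ⊥ , (λ ()) , λ ¬¬⊥ → ⊥-elim (¬¬⊥ lower)

⊤Ω¬¬ : Ω¬¬ v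
⊤Ω¬¬ = ⊤ , (λ _ _ → refl) , λ _ → _

⊥Ω¬¬≢⊤Ω¬¬ : ⊥Ω¬¬ {v} ≢ ⊤Ω¬¬
⊥Ω¬¬≢⊤Ω¬¬ eq with () ← subst (λ P → P) (sym (cong proj₁ eq)) _

constant⇒¬section : {B : Set b} (f : Ω¬¬ v → B) → (∀ P Q → f P ≡ f Q)
                  → (r : B → Ω¬¬ v) → ¬ (∀ P → r (f P) ≡ P)
constant⇒¬section f f-const r r∘f≗id = ⊥Ω¬¬≢⊤Ω¬¬ (begin
  ⊥Ω¬¬         ≡⟨ sym (r∘f≗id ⊥Ω¬¬) ⟩
  r (f ⊥Ω¬¬)   ≡⟨ cong r (f-const ⊥Ω¬¬ ⊤Ω¬¬) ⟩
  r (f ⊤Ω¬¬)   ≡⟨ r∘f≗id ⊤Ω¬¬ ⟩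
  ⊤Ω¬¬         ∎)
  where open ≡-Reasoning

module _ (𝓧 : Poset u w) where
  open Poset 𝓧

  ⋁δ-⊑-lower : {a b s : Carrier} {P : Set v} → isSup 𝓧 (δ 𝓧 a b P) s → ¬ P → s ⊑ a
  ⋁δ-⊑-lower {a = a} (_ , least) ¬P = least a λ
    { (inj₁ _) → ⊑-refl a
    ; (inj₂ p) → ⊥-elim (¬P p) }

  ⋁δ-⊑-lower⇒¬ : {a b s : Carrier} {P : Set v} → a ≢ b → a ⊑ b
               → isSup 𝓧 (δ 𝓧 a b P) s → s ⊑ a → ¬ P
  ⋁δ-⊑-lower⇒¬ {a = a} {b} {s} a≢b a⊑b (upper , _) s⊑a p =
    a≢b (⊑-antisym a b a⊑b (⊑-trans b s a (upper (inj₂ p)) s⊑a))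

  ⋁δ-diagonal : {a s : Carrier} {P : Set v} → isSup 𝓧 (δ 𝓧 a a P) s → s ≡ a
  ⋁δ-diagonal {a = a} {s} (upper , least) =
    ⊑-antisym s a (least a λ { (inj₁ _) → ⊑-refl a ; (inj₂ _) → ⊑-refl a }) (upper (inj₁ _))

  Δ-constant : (c : δ-complete 𝓧 v) {x y : Carrier} (x⊑y : x ⊑ y) → x ≡ y
             → (P Q : Ω v) → Δ 𝓧 c x y x⊑y P ≡ Δ 𝓧 c x y x⊑y Q
  Δ-constant c x⊑y refl (P , P-prop) (Q , Q-prop) =
    trans (⋁δ-diagonal (proj₂ (c _ _ x⊑y P P-prop)))
          (sym (⋁δ-diagonal (proj₂ (c _ _ x⊑y Q Q-prop))))

  Δ∘ι-section : Extensionality v v → PropExt v → LocallySmall 𝓧 v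
              → (c : δ-complete 𝓧 v) {x y : Carrier} (x⊑y : x ⊑ y) → x ≢ y
              → Σ (Carrier → Ω¬¬ v) (λ r → (P : Ω¬¬ v) → r (Δ 𝓧 c x y x⊑y (ι P)) ≡ P)
  Δ∘ι-section {v} ext pe (_⊑ᵥ_ , ⊑⇔⊑ᵥ) c {x} {y} x⊑y x≢y = r , r∘Δ∘ι≗id
    where
    ext₀ : Extensionality v 0ℓ
    ext₀ = lower-extensionality 0ℓ v ext

    r : Carrier → Ω¬¬ v
    r z = ¬-Ω¬¬ ext₀ (z ⊑ᵥ x)

    r∘Δ∘ι≗id : (P : Ω¬¬ v) → r (Δ 𝓧 c x y x⊑y (ι P)) ≡ P
    r∘Δ∘ι≗id (P , P-prop , P-stable) =
      Ω¬¬-≡ ext _ _ (pe (isProp-¬ ext₀) P-prop ¬⋁δ⊑x⇒P P⇒¬⋁δ⊑x)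
      where
      ⋁δ : Σ Carrier (isSup 𝓧 (δ 𝓧 x y P))
      ⋁δ = c x y x⊑y P P-prop

      ¬⋁δ⊑x⇒P : ¬ (proj₁ ⋁δ ⊑ᵥ x) → P
      ¬⋁δ⊑x⇒P ¬⋁δ⊑x = P-stable λ ¬P →
        ¬⋁δ⊑x (Inverse.to (⊑⇔⊑ᵥ _ x) (⋁δ-⊑-lower (proj₂ ⋁δ) ¬P))

      P⇒¬⋁δ⊑x : P → ¬ (proj₁ ⋁δ ⊑ᵥ x)
      P⇒¬⋁δ⊑x p ⋁δ⊑x =
        ⋁δ-⊑-lower⇒¬ x≢y x⊑y (proj₂ ⋁δ) (Inverse.from (⊑⇔⊑ᵥ _ x) ⋁δ⊑x) p

lemma4p21 : {u w v : Level} → Extensionality v v → PropExt v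
    → (𝓧 : Poset u w) → LocallySmall 𝓧 v → (c : δ-complete 𝓧 v)
    → (x y : Poset.Carrier 𝓧) → (x⊑y : Poset._⊑_ 𝓧 x y)
    → (x ≢ y) ⇔ Σ (Poset.Carrier 𝓧 → Ω¬¬ v) (λ r → (P : Ω¬¬ v) → r (Δ 𝓧 c x y x⊑y (ι P)) ≡ P)
lemma4p21 ext pe 𝓧 ls c x y x⊑y = mk⇔
  (Δ∘ι-section 𝓧 ext pe ls c x⊑y)
  (λ (r , r∘Δ∘ι≗id) x≡y →
    constant⇒¬section (Δ 𝓧 c x y x⊑y ∘ ι)
      (λ P Q → Δ-constant 𝓧 c x⊑y x≡y (ι P) (ι Q)) r r∘Δ∘ι≗id)
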